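{- For $n\ge 2$ let $a_k$ denote the number of subtrees of the complete graph $K_n$ having exactly $k$ edges ($1\le k\le n-1$), and define the uniform density and the weighted density $$\mu_p(n)=\frac{\sum_{k=1}^{n-1}k a_k}{(n-1)\sum_{k=1}^{n-1}a_k},\qquad \mu_q(n)=\frac{\sum_{k=1}^{n-1}k^2 a_k}{(n-1)\sum_{k=1}^{n-1}k a_k}.$$ Then (1) $\lim_{n\to\infty}\mu_p(n)=1$ and (2) $\lim_{n\to\infty}\mu_q(n)=1$.
   Context: A subtree of a graph is a subgraph that is a tree. By Cayley's formula $a_k=\binom{n}{k+1}(k+1)^{k-1}$. -}

module Defs where

open import Data.Nat using (ℕ; zero; suc; _+_; _*_; _∸_; _^_; _≤_)
open import Data.Nat.Combinatorics using (_C_)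
open import Data.Integer using (+_)
open import Data.Rational using (ℚ; 0ℚ; _/_; _-_; ∣_∣; _<_)
open import Data.Product using (∃-syntax)

-- a n k : number of subtrees of K_n with exactly k edges (k ≥ 1),
-- given by Cayley's formula:  a_k = C(n,k+1) (k+1)^(k-1).
a : ℕ → ℕ → ℕ
a n k = (n C suc k) * (suc k ^ (k ∸ 1))

Σ1 : ℕ → (ℕ → ℕ) → ℕ
Σ1 zero    f = 0
Σ1 (suc m) f = Σ1 m f + f (suc m)

S0 S1 S2 : ℕ → ℕ
S0 n = Σ1 (n ∸ 1) (λ k → a n k)
S1 n = Σ1 (n ∸ 1) (λ k → k * a n k)
S2 n = Σ1 (n ∸ 1) (λ k → k * k * a n k)

-- p / q as a rational; denominator 0 (which never happens for n ≥ 2) gives 0.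
div : ℕ → ℕ → ℚ
div p zero    = 0ℚ
div p (suc q) = (+ p) / suc q

μp μq : ℕ → ℚ
μp n = div (S1 n) ((n ∸ 1) * S0 n)
μq n = div (S2 n) ((n ∸ 1) * S1 n)

Tendsto : (ℕ → ℚ) → ℚ → Set
Tendsto f L = ∀ (ε : ℚ) → 0ℚ < ε → ∃[ N ] (∀ n → N ≤ n → ∣ f n - L ∣ < ε)

-- With m = n − 1, the absorption identity C(n,k+1)·(n−k−1) = C(n,k+2)·(k+2) and
-- (k+1)^(k−1) ≤ (k+2)^(k−1) give (m − k)·a_k ≤ a_{k+1}: the counts grow so fast that
-- for the weights w_k = a_k and w_k = k·a_k one has m·w_k ≤ k·w_k + w_{k+1}. Summing,
-- m·Σ w ≤ Σ k·w + Σ w, while trivially Σ k·w ≤ m·Σ w. Hence both densities lie in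
-- [1 − 1/m, 1].
module Submission where

open import Defs
open import Data.Nat using (ℕ; zero; suc; _+_; _*_; _∸_; _^_; _≤_; _<_; z≤n; s≤s; >-nonZero)
open import Data.Nat.Properties
open import Algebra.Properties.CommutativeSemigroup +-commutativeSemigroup
  using () renaming (interchange to +-interchange)
open import Algebra.Properties.CommutativeSemigroup *-commutativeSemigroup
  using () renaming (x∙yz≈y∙xz to x*[y*z]≡y*[x*z])
open import Data.Nat.Combinatorics using (_C_; nC1≡n; k>n⇒nCk≡0; nCk+nC[k+1]≡[n+1]C[k+1])
open import Data.Nat.Coprimality using (Coprime)
open import Data.Integer as ℤ using (+[1+_]; -[1+_])
import Data.Integer.Properties as ℤ
open import Data.Rational as ℚ using (mkℚ; 1ℚ; toℚᵘ)
import Data.Rational.Properties as ℚ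
open import Data.Rational.Unnormalised as ℚᵘ using (mkℚᵘ)
import Data.Rational.Unnormalised.Properties as ℚᵘ
open import Data.Product using (_×_; _,_)
open import Relation.Binary.PropositionalEquality
open import Relation.Nullary using (yes; no)

Σ1-cong : ∀ m {f g : ℕ → ℕ} → (∀ k → f k ≡ g k) → Σ1 m f ≡ Σ1 m g
Σ1-cong zero    f≡g = refl
Σ1-cong (suc m) f≡g = cong₂ _+_ (Σ1-cong m f≡g) (f≡g (suc m))

Σ1-mono-≤ : ∀ m {f g : ℕ → ℕ} → (∀ k → 1 ≤ k → k ≤ m → f k ≤ g k) → Σ1 m f ≤ Σ1 m g
Σ1-mono-≤ zero    f≤g = z≤n
Σ1-mono-≤ (suc m) f≤g =
  +-mono-≤ (Σ1-mono-≤ m λ k 1≤k k≤m → f≤g k 1≤k (m≤n⇒m≤1+n k≤m)) (f≤g (suc m) (s≤s z≤n) ≤-refl)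

Σ1-distrib-+ : ∀ m (f g : ℕ → ℕ) → Σ1 m (λ k → f k + g k) ≡ Σ1 m f + Σ1 m g
Σ1-distrib-+ zero    f g = refl
Σ1-distrib-+ (suc m) f g = trans (cong (_+ (f (suc m) + g (suc m))) (Σ1-distrib-+ m f g))
                                 (+-interchange (Σ1 m f) (Σ1 m g) (f (suc m)) (g (suc m)))

*-distribˡ-Σ1 : ∀ c m (f : ℕ → ℕ) → c * Σ1 m f ≡ Σ1 m (λ k → c * f k)
*-distribˡ-Σ1 c zero    f = *-zeroʳ c
*-distribˡ-Σ1 c (suc m) f = trans (*-distribˡ-+ c (Σ1 m f) (f (suc m)))
                                  (cong (_+ c * f (suc m)) (*-distribˡ-Σ1 c m f))

Σ1-shift : ∀ m (f : ℕ → ℕ) → Σ1 (suc m) f ≡ f 1 + Σ1 m (λ k → f (suc k))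
Σ1-shift zero    f = +-comm 0 (f 1)
Σ1-shift (suc m) f = trans (cong (_+ f (suc (suc m))) (Σ1-shift m f))
                           (+-assoc (f 1) (Σ1 m (λ k → f (suc k))) (f (suc (suc m))))

Σ1-first : ∀ m (f : ℕ → ℕ) → f 1 ≤ Σ1 (suc m) f
Σ1-first m f = subst (f 1 ≤_) (sym (Σ1-shift m f)) (m≤m+n (f 1) _)

Σ1[k*f]≤m*Σ1f : ∀ m (f : ℕ → ℕ) → Σ1 m (λ k → k * f k) ≤ m * Σ1 m f
Σ1[k*f]≤m*Σ1f m f = begin
  Σ1 m (λ k → k * f k) ≤⟨ Σ1-mono-≤ m (λ k _ k≤m → *-monoˡ-≤ (f k) k≤m) ⟩
  Σ1 m (λ k → m * f k) ≡⟨ *-distribˡ-Σ1 m m f ⟨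
  m * Σ1 m f           ∎
  where open ≤-Reasoning

m*Σ1f≤Σ1[k*f]+Σ1f : ∀ m (f : ℕ → ℕ) →
                    (∀ k → 1 ≤ k → k ≤ m → (m ∸ k) * f k ≤ f (suc k)) → f (suc m) ≡ 0 →
                    m * Σ1 m f ≤ Σ1 m (λ k → k * f k) + Σ1 m f
m*Σ1f≤Σ1[k*f]+Σ1f m f growth top = begin
  m * Σ1 m f                                     ≡⟨ *-distribˡ-Σ1 m m f ⟩
  Σ1 m (λ k → m * f k)                           ≤⟨ Σ1-mono-≤ m pointwise ⟩
  Σ1 m (λ k → k * f k + f (suc k))               ≡⟨ Σ1-distrib-+ m (λ k → k * f k) (λ k → f (suc k)) ⟩
  Σ1 m (λ k → k * f k) + Σ1 m (λ k → f (suc k)) ≤⟨ +-monoʳ-≤ (Σ1 m (λ k → k * f k)) shifted ⟩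
  Σ1 m (λ k → k * f k) + Σ1 m f                  ∎
  where
  open ≤-Reasoning
  pointwise : ∀ k → 1 ≤ k → k ≤ m → m * f k ≤ k * f k + f (suc k)
  pointwise k 1≤k k≤m = begin
    m * f k                 ≡⟨ cong (_* f k) (m+[n∸m]≡n k≤m) ⟨
    (k + (m ∸ k)) * f k     ≡⟨ *-distribʳ-+ (f k) k (m ∸ k) ⟩
    k * f k + (m ∸ k) * f k ≤⟨ +-monoʳ-≤ (k * f k) (growth k 1≤k k≤m) ⟩
    k * f k + f (suc k)     ∎
  shifted : Σ1 m (λ k → f (suc k)) ≤ Σ1 m f
  shifted = begin
    Σ1 m (λ k → f (suc k))       ≤⟨ m≤n+m _ (f 1) ⟩
    f 1 + Σ1 m (λ k → f (suc k)) ≡⟨ Σ1-shift m f ⟨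
    Σ1 m f + f (suc m)           ≡⟨ cong (Σ1 m f +_) top ⟩
    Σ1 m f + 0                   ≡⟨ +-identityʳ (Σ1 m f) ⟩
    Σ1 m f                       ∎

[m∸k]*k*f≤[1+k]*f[1+k] : ∀ m k {f : ℕ → ℕ} → (m ∸ k) * f k ≤ f (suc k) →
                         (m ∸ k) * (k * f k) ≤ suc k * f (suc k)
[m∸k]*k*f≤[1+k]*f[1+k] m k {f} growth = begin
  (m ∸ k) * (k * f k) ≡⟨ x*[y*z]≡y*[x*z] (m ∸ k) k (f k) ⟩
  k * ((m ∸ k) * f k) ≤⟨ *-mono-≤ (n≤1+n k) growth ⟩
  suc k * f (suc k)   ∎
  where open ≤-Reasoning

n≤k⇒nCk*[n∸k]≡nC[1+k]*[1+k] : ∀ {n k} → n ≤ k → (n C k) * (n ∸ k) ≡ (n C suc k) * suc k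
n≤k⇒nCk*[n∸k]≡nC[1+k]*[1+k] {n} {k} n≤k = begin
  (n C k) * (n ∸ k)   ≡⟨ cong ((n C k) *_) (m≤n⇒m∸n≡0 n≤k) ⟩
  (n C k) * 0         ≡⟨ *-zeroʳ (n C k) ⟩
  0 * suc k           ≡⟨ cong (_* suc k) (k>n⇒nCk≡0 (s≤s n≤k)) ⟨
  (n C suc k) * suc k ∎
  where open ≡-Reasoning

nCk*[n∸k]≡nC[1+k]*[1+k] : ∀ n k → (n C k) * (n ∸ k) ≡ (n C suc k) * suc k
nCk*[n∸k]≡nC[1+k]*[1+k] zero    k       = n≤k⇒nCk*[n∸k]≡nC[1+k]*[1+k] {k = k} z≤n
nCk*[n∸k]≡nC[1+k]*[1+k] (suc n) zero    = begin
  (suc n C 0) * suc n ≡⟨ *-identityˡ (suc n) ⟩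
  suc n               ≡⟨ nC1≡n (suc n) ⟨
  suc n C 1           ≡⟨ *-identityʳ (suc n C 1) ⟨
  (suc n C 1) * 1     ∎
  where open ≡-Reasoning
nCk*[n∸k]≡nC[1+k]*[1+k] (suc n) (suc k) with k <? n
... | no  k≮n = n≤k⇒nCk*[n∸k]≡nC[1+k]*[1+k] (s≤s (≮⇒≥ k≮n))
... | yes k<n = trans lhs≡ (sym rhs≡)
  where
  open ≡-Reasoning
  c₀ = n C k
  c₁ = n C suc k
  c₂ = n C suc (suc k)
  lhs≡ : (suc n C suc k) * (n ∸ k) ≡ c₁ * suc n
  lhs≡ = begin
    (suc n C suc k) * (n ∸ k)       ≡⟨ cong (_* (n ∸ k)) (nCk+nC[k+1]≡[n+1]C[k+1] n k) ⟨
    (c₀ + c₁) * (n ∸ k)             ≡⟨ *-distribʳ-+ (n ∸ k) c₀ c₁ ⟩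
    c₀ * (n ∸ k) + c₁ * (n ∸ k)     ≡⟨ cong (_+ c₁ * (n ∸ k)) (nCk*[n∸k]≡nC[1+k]*[1+k] n k) ⟩
    c₁ * suc k + c₁ * (n ∸ k)       ≡⟨ *-distribˡ-+ c₁ (suc k) (n ∸ k) ⟨
    c₁ * (suc k + (n ∸ k))          ≡⟨ cong (λ x → c₁ * suc x) (m+[n∸m]≡n (<⇒≤ k<n)) ⟩
    c₁ * suc n                      ∎
  rhs≡ : (suc n C suc (suc k)) * suc (suc k) ≡ c₁ * suc n
  rhs≡ = begin
    (suc n C suc (suc k)) * suc (suc k)     ≡⟨ cong (_* suc (suc k)) (nCk+nC[k+1]≡[n+1]C[k+1] n (suc k)) ⟨
    (c₁ + c₂) * suc (suc k)                 ≡⟨ *-distribʳ-+ (suc (suc k)) c₁ c₂ ⟩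
    c₁ * suc (suc k) + c₂ * suc (suc k)     ≡⟨ cong (c₁ * suc (suc k) +_) (nCk*[n∸k]≡nC[1+k]*[1+k] n (suc k)) ⟨
    c₁ * suc (suc k) + c₁ * (n ∸ suc k)     ≡⟨ *-distribˡ-+ c₁ (suc (suc k)) (n ∸ suc k) ⟨
    c₁ * (suc (suc k) + (n ∸ suc k))        ≡⟨ cong (λ x → c₁ * suc x) (m+[n∸m]≡n k<n) ⟩
    c₁ * suc n                              ∎

n≤k⇒a[n,k]≡0 : ∀ n k → n ≤ k → a n k ≡ 0
n≤k⇒a[n,k]≡0 n k n≤k = cong (_* (suc k ^ (k ∸ 1))) (k>n⇒nCk≡0 (s≤s n≤k))

[m∸k]*a[1+m,k]≤a[1+m,1+k] : ∀ m k → 1 ≤ k → (m ∸ k) * a (suc m) k ≤ a (suc m) (suc k)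
[m∸k]*a[1+m,k]≤a[1+m,1+k] m k@(suc j) _ = begin
  (m ∸ k) * (Cₖ₊₁ * suc k ^ j)           ≡⟨ *-assoc (m ∸ k) Cₖ₊₁ (suc k ^ j) ⟨
  ((m ∸ k) * Cₖ₊₁) * suc k ^ j           ≡⟨ cong (_* suc k ^ j) (*-comm (m ∸ k) Cₖ₊₁) ⟩
  (Cₖ₊₁ * (suc m ∸ suc k)) * suc k ^ j   ≡⟨ cong (_* suc k ^ j) (nCk*[n∸k]≡nC[1+k]*[1+k] (suc m) (suc k)) ⟩
  (Cₖ₊₂ * suc (suc k)) * suc k ^ j       ≤⟨ *-monoʳ-≤ (Cₖ₊₂ * suc (suc k)) (^-monoˡ-≤ j (n≤1+n (suc k))) ⟩
  (Cₖ₊₂ * suc (suc k)) * suc (suc k) ^ j ≡⟨ *-assoc Cₖ₊₂ (suc (suc k)) (suc (suc k) ^ j) ⟩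
  Cₖ₊₂ * suc (suc k) ^ k                 ∎
  where
  open ≤-Reasoning
  Cₖ₊₁ = suc m C suc k
  Cₖ₊₂ = suc m C suc (suc k)

1≤a[2+m,1] : ∀ m → 1 ≤ a (suc (suc m)) 1
1≤a[2+m,1] m = begin
  1                     ≤⟨ s≤s z≤n ⟩
  suc m                 ≡⟨ nC1≡n (suc m) ⟨
  suc m C 1             ≤⟨ m≤m+n (suc m C 1) (suc m C 2) ⟩
  suc m C 1 + suc m C 2 ≡⟨ nCk+nC[k+1]≡[n+1]C[k+1] (suc m) 1 ⟩
  suc (suc m) C 2       ≡⟨ *-identityʳ (suc (suc m) C 2) ⟨
  a (suc (suc m)) 1     ∎
  where open ≤-Reasoning

S1≤m*S0 : ∀ m → S1 (suc m) ≤ m * S0 (suc m)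
S1≤m*S0 m = Σ1[k*f]≤m*Σ1f m (a (suc m))

m*S0≤S1+S0 : ∀ m → m * S0 (suc m) ≤ S1 (suc m) + S0 (suc m)
m*S0≤S1+S0 m = m*Σ1f≤Σ1[k*f]+Σ1f m (a (suc m))
  (λ k 1≤k _ → [m∸k]*a[1+m,k]≤a[1+m,1+k] m k 1≤k) (n≤k⇒a[n,k]≡0 (suc m) (suc m) ≤-refl)

S2≡Σ1[k*[k*a]] : ∀ m → S2 (suc m) ≡ Σ1 m (λ k → k * (k * a (suc m) k))
S2≡Σ1[k*[k*a]] m = Σ1-cong m (λ k → *-assoc k k (a (suc m) k))

S2≤m*S1 : ∀ m → S2 (suc m) ≤ m * S1 (suc m)
S2≤m*S1 m = subst (_≤ m * S1 (suc m)) (sym (S2≡Σ1[k*[k*a]] m))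
  (Σ1[k*f]≤m*Σ1f m (λ k → k * a (suc m) k))

m*S1≤S2+S1 : ∀ m → m * S1 (suc m) ≤ S2 (suc m) + S1 (suc m)
m*S1≤S2+S1 m = subst (λ x → m * S1 (suc m) ≤ x + S1 (suc m)) (sym (S2≡Σ1[k*[k*a]] m))
  (m*Σ1f≤Σ1[k*f]+Σ1f m (λ k → k * a (suc m) k)
    (λ k 1≤k _ → [m∸k]*k*f≤[1+k]*f[1+k] m k {a (suc m)} ([m∸k]*a[1+m,k]≤a[1+m,1+k] m k 1≤k))
    (trans (cong (suc m *_) (n≤k⇒a[n,k]≡0 (suc m) (suc m) ≤-refl)) (*-zeroʳ (suc m))))

1≤S0 : ∀ m → 1 ≤ S0 (suc (suc m))
1≤S0 m = ≤-trans (1≤a[2+m,1] m) (Σ1-first m (a (suc (suc m))))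

1≤S1 : ∀ m → 1 ≤ S1 (suc (suc m))
1≤S1 m = ≤-trans (subst (1 ≤_) (sym (*-identityˡ _)) (1≤a[2+m,1] m))
                 (Σ1-first m (λ k → k * a (suc (suc m)) k))

-- The numerator of the unnormalised fraction p/q − 1, in the shape it computes to.
∣p*1-1*q∣≡q∸p : ∀ {p q} → p ≤ q → ℤ.∣ ℤ.+ p ℤ.* ℤ.1ℤ ℤ.+ ℤ.-1ℤ ℤ.* ℤ.+ q ∣ ≡ q ∸ p
∣p*1-1*q∣≡q∸p {p} {q} p≤q = begin
  ℤ.∣ ℤ.+ p ℤ.* ℤ.1ℤ ℤ.+ ℤ.-1ℤ ℤ.* ℤ.+ q ∣ ≡⟨ cong ℤ.∣_∣ (cong₂ ℤ._+_ (ℤ.*-identityʳ (ℤ.+ p)) (ℤ.-1*i≡-i (ℤ.+ q))) ⟩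
  ℤ.∣ ℤ.+ p ℤ.- ℤ.+ q ∣                    ≡⟨ cong ℤ.∣_∣ (ℤ.m-n≡m⊖n p q) ⟩
  ℤ.∣ p ℤ.⊖ q ∣                            ≡⟨ ℤ.∣⊖∣-≤ p≤q ⟩
  q ∸ p                                    ∎
  where open ≡-Reasoning

-- div p q is the normalisation of the unnormalised p/q, so the claim is a cross-multiplied
-- inequality in ℚᵘ.
∣div[p,q]-1∣<mkℚ : ∀ {p q k d} .(c : Coprime (suc k) (suc d)) → 1 ≤ q → p ≤ q →
                   (q ∸ p) * suc d < suc k * q → ℚ.∣ div p q ℚ.- 1ℚ ∣ ℚ.< mkℚ +[1+ k ] d c
∣div[p,q]-1∣<mkℚ {p} {q@(suc q′)} {k} {d} c _ p≤q defect =
  ℚ.toℚᵘ-cancel-< (ℚᵘ.<-respˡ-≃ (ℚᵘ.≃-sym toℚᵘ-lhs) (ℚᵘ.*<* cross-multiplied))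
  where
  toℚᵘ-lhs : toℚᵘ (ℚ.∣ div p q ℚ.- 1ℚ ∣) ℚᵘ.≃ ℚᵘ.∣ mkℚᵘ (ℤ.+ p) q′ ℚᵘ.- ℚᵘ.1ℚᵘ ∣
  toℚᵘ-lhs = ℚᵘ.≃-trans (ℚ.toℚᵘ-homo-∣-∣ (div p q ℚ.- 1ℚ))
    (ℚᵘ.∣-∣-cong (ℚᵘ.≃-trans (ℚ.toℚᵘ-homo-+ (div p q) (ℚ.- 1ℚ))
                             (ℚᵘ.+-congˡ (ℚᵘ.- ℚᵘ.1ℚᵘ) (ℚ.toℚᵘ-fromℚᵘ (mkℚᵘ (ℤ.+ p) q′)))))
  cross-multiplied : ℤ.+ ℤ.∣ ℤ.+ p ℤ.* ℤ.1ℤ ℤ.+ ℤ.-1ℤ ℤ.* ℤ.+ q ∣ ℤ.* ℤ.+ suc d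
                     ℤ.< +[1+ k ] ℤ.* ℤ.+ suc (q′ * 1)
  cross-multiplied = begin-strict
    ℤ.+ ℤ.∣ ℤ.+ p ℤ.* ℤ.1ℤ ℤ.+ ℤ.-1ℤ ℤ.* ℤ.+ q ∣ ℤ.* ℤ.+ suc d
      ≡⟨ cong (λ x → ℤ.+ x ℤ.* ℤ.+ suc d) (∣p*1-1*q∣≡q∸p p≤q) ⟩
    ℤ.+ (q ∸ p) ℤ.* ℤ.+ suc d      ≡⟨ ℤ.pos-* (q ∸ p) (suc d) ⟨
    ℤ.+ ((q ∸ p) * suc d)          <⟨ ℤ.+<+ defect ⟩
    ℤ.+ (suc k * q)                ≡⟨ cong (λ x → ℤ.+ (suc k * suc x)) (*-identityʳ q′) ⟨
    ℤ.+ (suc k * suc (q′ * 1))     ≡⟨ ℤ.pos-* (suc k) (suc (q′ * 1)) ⟩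
    +[1+ k ] ℤ.* ℤ.+ suc (q′ * 1)  ∎
    where open ℤ.≤-Reasoning

-- ε = (k+1)/(d+1) ≥ 1/(d+1), and for n ≥ d + 3 the defect is at most 1/(n−1) < 1/(d+1).
ratio-tendsto-one : (P D : ℕ → ℕ) → (∀ m → 1 ≤ D (suc (suc m))) →
                    (∀ m → P (suc m) ≤ m * D (suc m)) →
                    (∀ m → m * D (suc m) ≤ P (suc m) + D (suc m)) →
                    Tendsto (λ n → div (P n) ((n ∸ 1) * D n)) 1ℚ
ratio-tendsto-one P D 1≤D upper lower (mkℚ +[1+ k ] d c) _ = 3 + d , close
  where
  close : ∀ n → 3 + d ≤ n → ℚ.∣ div (P n) ((n ∸ 1) * D n) ℚ.- 1ℚ ∣ ℚ.< mkℚ +[1+ k ] d c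
  close (suc n@(suc m)) (s≤s (s≤s d<m)) = ∣div[p,q]-1∣<mkℚ c 1≤q (upper n) defect
    where
    Dₙ = D (suc n)
    Pₙ = P (suc n)
    instance _ = >-nonZero (1≤D m)
    1≤q : 1 ≤ n * Dₙ
    1≤q = *-mono-≤ {1} {n} (s≤s z≤n) (1≤D m)
    defect : (n * Dₙ ∸ Pₙ) * suc d < suc k * (n * Dₙ)
    defect = begin-strict
      (n * Dₙ ∸ Pₙ) * suc d ≤⟨ *-monoˡ-≤ (suc d) (m≤n+o⇒m∸n≤o (n * Dₙ) Pₙ (lower n)) ⟩
      Dₙ * suc d            <⟨ *-monoʳ-< Dₙ (s≤s d<m) ⟩
      Dₙ * n                ≡⟨ *-comm Dₙ n ⟩
      n * Dₙ                ≤⟨ m≤m+n (n * Dₙ) (k * (n * Dₙ)) ⟩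
      suc k * (n * Dₙ)      ∎
      where open ≤-Reasoning
ratio-tendsto-one _ _ _ _ _ (mkℚ (ℤ.+ 0)   _ _) (ℚ.*<* (ℤ.+<+ ()))
ratio-tendsto-one _ _ _ _ _ (mkℚ -[1+ _ ] _ _) (ℚ.*<* ())

theorem1p2 : Tendsto μp 1ℚ × Tendsto μq 1ℚ
theorem1p2 = ratio-tendsto-one S1 S0 1≤S0 S1≤m*S0 m*S0≤S1+S0
           , ratio-tendsto-one S2 S1 1≤S1 S2≤m*S1 m*S1≤S2+S1
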